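{- Let $S = \mathcal{C}_1\land\cdots\land\mathcal{C}_m$ be a SAT problem in conjunctive normal form over the Boolean variables $\rho_1,\dots,\rho_n$, each clause consisting of $k$ literals on distinct variables. For each $j$ let $\mathcal{T}'_j := \{\lambda \in O(1)^n : M(z_j) \subseteq \lambda(P)\}$. Then $S$ is unsatisfiable if and only if $\bigcup_{j=1}^m \mathcal{T}'_j = O(1)^n$.
   Context: $\mathbb{R}^{n,n}$ is the real $2n$-dimensional vector space with orthonormal basis $e_1,\dots,e_{2n}$, $e_i^2=(-1)^{i+1}$, identified with $\mathbb{R}^n\times\mathbb{R}^n$ via $e_{2i-1}\mapsto(\epsilon_i,0)$, $e_{2i}\mapsto(0,\epsilon_i)$ ($\epsilon_i$ the standard basis of $\mathbb{R}^n$). The Witt basis is $p_i=\tfrac12(e_{2i-1}+e_{2i})$, $q_i=\tfrac12(e_{2i-1}-e_{2i})$, and $P=\mathrm{span}\{p_1,\dots,p_n\} = \{(x,x): x\in\mathbb{R}^n\}$. $O(1)^n$ is the group of diagonal $n\times n$ matrices with entries $\pm1$; $\lambda\in O(n)$ acts on $\mathbb{R}^{n,n}$ by $(x,y)\mapsto(x,\lambda y)$, so $\lambda(P) = \{(x,\lambda x)\}$ (for $\lambda\in O(1)^n$ this is the span of $p_i$ for $\lambda_{ii}=1$ and $q_i$ for $\lambda_{ii}=-1$). For a clause $\mathcal C_j$, $z_j$ denotes the unique partial assignment of its variables making $\mathcal C_j$ false, and $M(z_j)$ is the totally null subspace spanned by $p_i$ for each variable $\rho_i$ occurring positively in $\mathcal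 C_j$ and $q_i$ for each variable occurring negated in $\mathcal C_j$.
   Formalization: The space $\mathbb{R}^{n,n}$ is taken over ℚ rather than the reals: its vectors, the span coefficients of M(z_j) and the vectors x describing λ(P) have rational coordinates. -}

module Defs where

open import Data.Nat using (ℕ; zero; suc)
open import Data.Fin using (Fin; zero; suc)
open import Data.Bool using (Bool; true; false)
open import Data.Product using (Σ; ∃; _×_; _,_; proj₁; proj₂)
open import Data.Sum using (_⊎_)
open import Data.Sign using (Sign)
import Data.Sign as Sg
open import Data.Rational using (ℚ; 0ℚ; 1ℚ; ½; _+_; _*_; -_)
open import Relation.Binary.PropositionalEquality using (_≡_)

record Literal (n : ℕ) : Set where
  constructor lit
  field
    var      : Fin n
    positive : Bool
open Literal public

Clause : ℕ → ℕ → Set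
Clause n k = Fin k → Literal n

DistinctVars : ∀ {n k} → Clause n k → Set
DistinctVars {n} {k} C = (a b : Fin k) → var (C a) ≡ var (C b) → a ≡ b

CNF : ℕ → ℕ → ℕ → Set
CNF n m k = Fin m → Clause n k

Assignment : ℕ → Set
Assignment n = Fin n → Bool

SatisfiesLit : ∀ {n} → Assignment n → Literal n → Set
SatisfiesLit σ l = σ (var l) ≡ positive l

SatisfiesClause : ∀ {n k} → Assignment n → Clause n k → Set
SatisfiesClause {k = k} σ C = Σ (Fin k) λ a → SatisfiesLit σ (C a)

Satisfiable : ∀ {n m k} → CNF n m k → Set
Satisfiable {n} {m} S = Σ (Assignment n) λ σ → (j : Fin m) → SatisfiesClause σ (S j)

-- The split space R^{n,n} ≅ R^n × R^n (coordinates taken in ℚ)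

Vecⁿ : ℕ → Set
Vecⁿ n = Fin n → ℚ

Vⁿⁿ : ℕ → Set
Vⁿⁿ n = Vecⁿ n × Vecⁿ n

_≋_ : ∀ {n} → Vⁿⁿ n → Vⁿⁿ n → Set
_≋_ {n} (x , y) (x' , y') = ((i : Fin n) → x i ≡ x' i) × ((i : Fin n) → y i ≡ y' i)

zeroV : ∀ {n} → Vⁿⁿ n
zeroV = (λ _ → 0ℚ) , (λ _ → 0ℚ)

_⊕_ : ∀ {n} → Vⁿⁿ n → Vⁿⁿ n → Vⁿⁿ n
(x , y) ⊕ (x' , y') = (λ i → x i + x' i) , (λ i → y i + y' i)

_·_ : ∀ {n} → ℚ → Vⁿⁿ n → Vⁿⁿ n
c · (x , y) = (λ i → c * x i) , (λ i → c * y i)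

ε : ∀ {n} → Fin n → Vecⁿ n
ε zero    zero    = 1ℚ
ε zero    (suc _) = 0ℚ
ε (suc i) zero    = 0ℚ
ε (suc i) (suc j) = ε i j

-- e_{2i-1} ↦ (ε_i, 0), e_{2i} ↦ (0, ε_i)
eOdd eEven : ∀ {n} → Fin n → Vⁿⁿ n
eOdd  i = ε i , (λ _ → 0ℚ)
eEven i = (λ _ → 0ℚ) , ε i

p q : ∀ {n} → Fin n → Vⁿⁿ n
p i = ½ · (eOdd i ⊕ eEven i)
q i = ½ · (eOdd i ⊕ ((- 1ℚ) · eEven i))

∑ : ∀ {n} (k : ℕ) → (Fin k → Vⁿⁿ n) → Vⁿⁿ n
∑ zero    f = zeroV
∑ (suc k) f = f zero ⊕ ∑ k (λ a → f (suc a))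

InSpan : ∀ {n k} → (Fin k → Vⁿⁿ n) → Vⁿⁿ n → Set
InSpan {k = k} g v = Σ (Fin k → ℚ) λ c → v ≋ ∑ k (λ a → c a · g a)

-- O(1)^n: diagonal matrices with entries ±1, given by their diagonal

O1ⁿ : ℕ → Set
O1ⁿ n = Fin n → Sign

signℚ : Sign → ℚ
signℚ Sg.+ = 1ℚ
signℚ Sg.- = - 1ℚ

act : ∀ {n} → O1ⁿ n → Vecⁿ n → Vecⁿ n
act λ' x i = signℚ (λ' i) * x i

InλP : ∀ {n} → O1ⁿ n → Vⁿⁿ n → Set
InλP {n} λ' (u , w) = Σ (Vecⁿ n) λ x → (u , w) ≋ (x , act λ' x)

litVec : ∀ {n} → Literal n → Vⁿⁿ n
litVec (lit i true)  = p i
litVec (lit i false) = q i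

InM : ∀ {n k} → Clause n k → Vⁿⁿ n → Set
InM C = InSpan (λ a → litVec (C a))

InT' : ∀ {n m k} → CNF n m k → Fin m → O1ⁿ n → Set
InT' S j λ' = ∀ v → InM (S j) v → InλP λ' v

{-# OPTIONS --safe #-}
-- λ(P) = {(x, λx)} is a subspace, so M(z_j) ⊆ λ(P) iff every generator of M(z_j) lies
-- in λ(P); and pᵢ ∈ λ(P) iff λᵢᵢ = 1, qᵢ ∈ λ(P) iff λᵢᵢ = -1.  Reading λ as the
-- assignment with ρᵢ true iff λᵢᵢ = -1, this says λ ∈ 𝒯'_j iff λ falsifies 𝒞_j,
-- so the 𝒯'_j cover O(1)ⁿ iff every assignment falsifies some clause.
module Submission where

open import Defs
open import Algebra.Bundles using (CommutativeMonoid)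
open import Data.Bool using (Bool; true; false) renaming (_≟_ to _≟ᵇ_)
open import Data.Fin using (Fin; zero; suc; _≟_)
open import Data.Fin.Properties using (any?; ¬∀⟶∃¬)
open import Data.Nat using (ℕ)
open import Data.Product using (Σ; _×_; _,_; map₂)
open import Data.Rational using (ℚ; 0ℚ; 1ℚ; _+_; _*_)
import Data.Rational.Properties as ℚ
open import Data.Sign using (Sign)
import Data.Sign as Sign
open import Function using (_∘_)
open import Relation.Nullary using (¬_; Dec; yes; no; contradiction)
open import Relation.Binary.PropositionalEquality
open import Algebra.Properties.CommutativeSemigroup
  (CommutativeMonoid.commutativeSemigroup ℚ.*-1-commutativeMonoid) using (x∙yz≈y∙xz)

private
  variable
    n k : ℕ

truth : Sign → Bool
truth Sign.+ = false
truth Sign.- = true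

signOf : Bool → Sign
signOf false = Sign.+
signOf true  = Sign.-

truth-signOf : ∀ b → truth (signOf b) ≡ b
truth-signOf false = refl
truth-signOf true  = refl

assignmentOf : O1ⁿ n → Assignment n
assignmentOf λ' = truth ∘ λ'

Falsifies : Assignment n → Clause n k → Set
Falsifies σ C = ∀ a → ¬ SatisfiesLit σ (C a)

ε-diagonal : (i : Fin n) → ε i i ≡ 1ℚ
ε-diagonal zero    = refl
ε-diagonal (suc i) = ε-diagonal i

ε-offDiagonal : {i j : Fin n} → i ≢ j → ε i j ≡ 0ℚ
ε-offDiagonal {i = zero}  {zero}  i≢j = contradiction refl i≢j
ε-offDiagonal {i = zero}  {suc j} i≢j = refl
ε-offDiagonal {i = suc i} {zero}  i≢j = refl
ε-offDiagonal {i = suc i} {suc j} i≢j = ε-offDiagonal (i≢j ∘ cong suc)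

≋-refl : {v : Vⁿⁿ n} → v ≋ v
≋-refl = (λ _ → refl) , (λ _ → refl)

≋-sym : {u v : Vⁿⁿ n} → u ≋ v → v ≋ u
≋-sym (u₁≡v₁ , u₂≡v₂) = sym ∘ u₁≡v₁ , sym ∘ u₂≡v₂

≋-trans : {u v w : Vⁿⁿ n} → u ≋ v → v ≋ w → u ≋ w
≋-trans (u₁≡v₁ , u₂≡v₂) (v₁≡w₁ , v₂≡w₂) =
  (λ i → trans (u₁≡v₁ i) (v₁≡w₁ i)) , (λ i → trans (u₂≡v₂ i) (v₂≡w₂ i))

⊕-cong : {u u' v v' : Vⁿⁿ n} → u ≋ u' → v ≋ v' → (u ⊕ v) ≋ (u' ⊕ v')
⊕-cong (u₁≡ , u₂≡) (v₁≡ , v₂≡) =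
  (λ i → cong₂ _+_ (u₁≡ i) (v₁≡ i)) , (λ i → cong₂ _+_ (u₂≡ i) (v₂≡ i))

⊕-identityˡ : (v : Vⁿⁿ n) → (zeroV ⊕ v) ≋ v
⊕-identityˡ (x , y) = (λ i → ℚ.+-identityˡ (x i)) , (λ i → ℚ.+-identityˡ (y i))

⊕-identityʳ : (v : Vⁿⁿ n) → (v ⊕ zeroV) ≋ v
⊕-identityʳ (x , y) = (λ i → ℚ.+-identityʳ (x i)) , (λ i → ℚ.+-identityʳ (y i))

·-zeroˡ : (v : Vⁿⁿ n) → (0ℚ · v) ≋ zeroV
·-zeroˡ (x , y) = (λ i → ℚ.*-zeroˡ (x i)) , (λ i → ℚ.*-zeroˡ (y i))

·-identityˡ : (v : Vⁿⁿ n) → (1ℚ · v) ≋ v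
·-identityˡ (x , y) = (λ i → ℚ.*-identityˡ (x i)) , (λ i → ℚ.*-identityˡ (y i))

∑-zero : ∀ k (g : Fin k → Vⁿⁿ n) → ∑ k (λ b → 0ℚ · g b) ≋ zeroV
∑-zero ℕ.zero    g = ≋-refl
∑-zero (ℕ.suc k) g =
  ≋-trans (⊕-cong (·-zeroˡ (g zero)) (∑-zero k (g ∘ suc))) (⊕-identityˡ zeroV)

δ : Fin k → Fin k → ℚ
δ zero    zero    = 1ℚ
δ zero    (suc b) = 0ℚ
δ (suc a) zero    = 0ℚ
δ (suc a) (suc b) = δ a b

∑-δ : ∀ k (g : Fin k → Vⁿⁿ n) a → g a ≋ ∑ k (λ b → δ a b · g b)
∑-δ (ℕ.suc k) g zero = ≋-sym
  (≋-trans (⊕-cong (·-identityˡ (g zero)) (∑-zero k (g ∘ suc))) (⊕-identityʳ (g zero)))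
∑-δ (ℕ.suc k) g (suc a) = ≋-trans (∑-δ k (g ∘ suc) a) (≋-sym drop-head)
  where
  rest = ∑ k (λ b → δ a b · g (suc b))
  drop-head : ((0ℚ · g zero) ⊕ rest) ≋ rest
  drop-head = ≋-trans (⊕-cong (·-zeroˡ (g zero)) ≋-refl) (⊕-identityˡ rest)

generator∈span : (g : Fin k → Vⁿⁿ n) (a : Fin k) → InSpan g (g a)
generator∈span {k} g a = δ a , ∑-δ k g a

OnGraph : O1ⁿ n → Vⁿⁿ n → Set
OnGraph {n} λ' (x , y) = (i : Fin n) → y i ≡ signℚ (λ' i) * x i

OnGraph⇒InλP : (λ' : O1ⁿ n) (v : Vⁿⁿ n) → OnGraph λ' v → InλP λ' v
OnGraph⇒InλP λ' (x , y) y≡λx = x , (λ _ → refl) , y≡λx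

InλP⇒OnGraph : (λ' : O1ⁿ n) (v : Vⁿⁿ n) → InλP λ' v → OnGraph λ' v
InλP⇒OnGraph λ' (x , y) (x' , x≡x' , y≡λx') i =
  trans (y≡λx' i) (cong (signℚ (λ' i) *_) (sym (x≡x' i)))

OnGraph-resp-≋ : (λ' : O1ⁿ n) {u v : Vⁿⁿ n} → u ≋ v → OnGraph λ' v → OnGraph λ' u
OnGraph-resp-≋ λ' (x≡x' , y≡y') y'≡λx' i =
  trans (y≡y' i) (trans (y'≡λx' i) (cong (signℚ (λ' i) *_) (sym (x≡x' i))))

OnGraph-zero : (λ' : O1ⁿ n) → OnGraph λ' zeroV
OnGraph-zero λ' i = sym (ℚ.*-zeroʳ (signℚ (λ' i)))

OnGraph-⊕ : (λ' : O1ⁿ n) (u v : Vⁿⁿ n) → OnGraph λ' u → OnGraph λ' v → OnGraph λ' (u ⊕ v)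
OnGraph-⊕ λ' _ _ onU onV i =
  trans (cong₂ _+_ (onU i) (onV i)) (sym (ℚ.*-distribˡ-+ (signℚ (λ' i)) _ _))

OnGraph-· : (λ' : O1ⁿ n) (c : ℚ) (v : Vⁿⁿ n) → OnGraph λ' v → OnGraph λ' (c · v)
OnGraph-· λ' c _ onV i = trans (cong (c *_) (onV i)) (x∙yz≈y∙xz c (signℚ (λ' i)) _)

OnGraph-∑ : (λ' : O1ⁿ n) (c : Fin k → ℚ) (g : Fin k → Vⁿⁿ n) →
            (∀ a → OnGraph λ' (g a)) → OnGraph λ' (∑ k (λ a → c a · g a))
OnGraph-∑ {k = ℕ.zero}  λ' c g onG = OnGraph-zero λ'
OnGraph-∑ {k = ℕ.suc k} λ' c g onG =
  OnGraph-⊕ λ' _ _ (OnGraph-· λ' (c zero) (g zero) (onG zero))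
                   (OnGraph-∑ λ' (c ∘ suc) (g ∘ suc) (onG ∘ suc))

span-OnGraph : (λ' : O1ⁿ n) (g : Fin k → Vⁿⁿ n) →
               (∀ a → OnGraph λ' (g a)) → ∀ v → InSpan g v → OnGraph λ' v
span-OnGraph λ' g onG v (c , v≋) = OnGraph-resp-≋ λ' v≋ (OnGraph-∑ λ' c g onG)

litVec-OnGraph : (λ' : O1ⁿ n) (x : Literal n) →
                 ¬ SatisfiesLit (assignmentOf λ') x → OnGraph λ' (litVec x)
litVec-OnGraph λ' (lit i true) unsat j with i ≟ j
... | no i≢j rewrite ε-offDiagonal i≢j = OnGraph-zero λ' j
... | yes refl rewrite ε-diagonal i with λ' i
...   | Sign.+ = refl
...   | Sign.- = contradiction refl unsat
litVec-OnGraph λ' (lit i false) unsat j with i ≟ j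
... | no i≢j rewrite ε-offDiagonal i≢j = OnGraph-zero λ' j
... | yes refl rewrite ε-diagonal i with λ' i
...   | Sign.+ = contradiction refl unsat
...   | Sign.- = refl

-- At coordinate i the graph condition would read ½ = -½ (or -½ = ½); the other
-- value of λ' i is ruled out by sat, so its clause is omitted.
litVec-offGraph : (λ' : O1ⁿ n) (x : Literal n) →
                  SatisfiesLit (assignmentOf λ') x → ¬ OnGraph λ' (litVec x)
litVec-offGraph λ' (lit i true) sat onGraph
  with λ' i | ε i i | ε-diagonal i | onGraph i
... | Sign.- | _ | refl | ()
litVec-offGraph λ' (lit i false) sat onGraph
  with λ' i | ε i i | ε-diagonal i | onGraph i
... | Sign.+ | _ | refl | ()

falsifies⇒InT' : ∀ {m} (S : CNF n m k) j (λ' : O1ⁿ n) →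
                 Falsifies (assignmentOf λ') (S j) → InT' S j λ'
falsifies⇒InT' S j λ' falsified v v∈M =
  OnGraph⇒InλP λ' v (span-OnGraph λ' _ (λ a → litVec-OnGraph λ' (S j a) (falsified a)) v v∈M)

InT'⇒falsifies : ∀ {m} (S : CNF n m k) j (λ' : O1ⁿ n) →
                 InT' S j λ' → Falsifies (assignmentOf λ') (S j)
InT'⇒falsifies S j λ' M⊆λP a sat = litVec-offGraph λ' (S j a) sat
  (InλP⇒OnGraph λ' _ (M⊆λP _ (generator∈span (litVec ∘ S j) a)))

unsatisfiable⇒falsified : ∀ {m} (S : CNF n m k) → ¬ Satisfiable S →
                          (σ : Assignment n) → Σ (Fin m) λ j → Falsifies σ (S j)
unsatisfiable⇒falsified {m = m} S unsat σ =
  map₂ (λ ¬sat a σ⊨ → ¬sat (a , σ⊨)) (¬∀⟶∃¬ m _ satisfies? (λ sat → unsat (σ , sat)))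
  where
  satisfies? : ∀ j → Dec (SatisfiesClause σ (S j))
  satisfies? j = any? (λ a → σ (var (S j a)) ≟ᵇ positive (S j a))

proposition5 : (n m k : ℕ) (S : CNF n m k) →
    ((j : Fin m) → DistinctVars (S j)) →
    ((¬ Satisfiable S) → ((λ' : O1ⁿ n) → Σ (Fin m) λ j → InT' S j λ'))
    × (((λ' : O1ⁿ n) → Σ (Fin m) λ j → InT' S j λ') → ¬ Satisfiable S)
proposition5 n m k S _ = covered , uncovered
  where
  covered : ¬ Satisfiable S → (λ' : O1ⁿ n) → Σ (Fin m) λ j → InT' S j λ'
  covered unsat λ' with unsatisfiable⇒falsified S unsat (assignmentOf λ')
  ... | j , falsified = j , falsifies⇒InT' S j λ' falsified

  uncovered : ((λ' : O1ⁿ n) → Σ (Fin m) λ j → InT' S j λ') → ¬ Satisfiable S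
  uncovered cover (σ , sat) with cover (signOf ∘ σ)
  ... | j , M⊆λP with sat j
  ...   | a , σ⊨ = InT'⇒falsifies S j (signOf ∘ σ) M⊆λP a (trans (truth-signOf _) σ⊨)
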